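{- For every integer $n \geq 3$, let $\Delta(n)$ denote the maximum of $\Delta(T)$ over all tournaments $T$ with $n$ vertices. Then $\Delta(n) = \left\lceil \frac{n+1}{2} \right\rceil$.
   Context: A tournament $T$ is a finite vertex set $V(T)$ with an arc set $A(T)$ such that for all distinct $x,y$, exactly one of $(x,y),(y,x)$ lies in $A(T)$. A module of $T$ is a subset $M \subseteq V(T)$ such that for all $x,y \in M$ and $v \notin M$, $(v,x)\in A(T)$ iff $(v,y)\in A(T)$; the trivial modules are $\emptyset$, singletons and $V(T)$. For $X \subseteq V(T)$ write $\overline{X} = V(T)\setminus X$. A co-module of $T$ is a subset $M \subseteq V(T)$ such that $M$ or $\overline{M}$ is a nontrivial module of $T$. A co-modular decomposition of $T$ is a set of pairwise disjoint co-modules of $T$. The co-modular index $\Delta(T)$ is the largest size of a co-modular decomposition of $T$. -}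

module Defs where

open import Data.Nat using (ℕ; _≤_)
open import Data.Bool using (Bool; true; false; not)
open import Data.Fin using (Fin)
open import Data.Fin.Subset using (Subset; _∈_; _∉_; ⊥; ⊤; ⁅_⁆; ∁; _∩_; Empty)
open import Data.List using (List; length)
open import Data.List.Relation.Unary.All using (All)
open import Data.List.Relation.Unary.AllPairs using (AllPairs)
open import Data.Product using (Σ; _×_)
open import Data.Sum using (_⊎_)
open import Relation.Nullary using (¬_)
open import Relation.Binary.PropositionalEquality using (_≡_; _≢_)

record Tournament (n : ℕ) : Set where
  field
    arc   : Fin n → Fin n → Bool
    irrefl : ∀ x → arc x x ≡ false
    tourn  : ∀ x y → x ≢ y → arc y x ≡ not (arc x y)
open Tournament public

IsModule : ∀ {n} → Tournament n → Subset n → Set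
IsModule T M = ∀ x y v → x ∈ M → y ∈ M → v ∉ M → (arc T v x ≡ true → arc T v y ≡ true) × (arc T v y ≡ true → arc T v x ≡ true)

IsTrivial : ∀ {n} → Subset n → Set
IsTrivial {n} M = (M ≡ ⊥) ⊎ (Σ (Fin n) (λ x → M ≡ ⁅ x ⁆)) ⊎ (M ≡ ⊤)

IsNontrivialModule : ∀ {n} → Tournament n → Subset n → Set
IsNontrivialModule T M = IsModule T M × ¬ IsTrivial M

IsCoModule : ∀ {n} → Tournament n → Subset n → Set
IsCoModule T M = IsNontrivialModule T M ⊎ IsNontrivialModule T (∁ M)

Disjoint : ∀ {n} → Subset n → Subset n → Set
Disjoint M N = Empty (M ∩ N)

-- A co-modular decomposition, given as a list of pairwise disjoint co-modules.
-- (Co-modules are nonempty, so pairwise disjointness forces the entries to be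
-- distinct, and the list length is the size of the corresponding set.)
IsCoModularDecomposition : ∀ {n} → Tournament n → List (Subset n) → Set
IsCoModularDecomposition T D = All (IsCoModule T) D × AllPairs Disjoint D

IsCoModularIndex : ∀ {n} → Tournament n → ℕ → Set
IsCoModularIndex {n} T k =
  Σ (List (Subset n)) (λ D → IsCoModularDecomposition T D × length D ≡ k)
  × (∀ D → IsCoModularDecomposition T D → length D ≤ k)

IsMaxCoModularIndex : ℕ → ℕ → Set
IsMaxCoModularIndex n k =
  Σ (Tournament n) (λ T → IsCoModularIndex T k)
  × (∀ (T : Tournament n) m → IsCoModularIndex T m → m ≤ k)

module Submission where

-- Call a vertex
-- extremal when it dominates, or is dominated by, every other vertex; no
-- three distinct vertices are extremal.  A co-module M is nonempty, and if
-- it is a singleton {x} then V ∖ {x} is a nontrivial module, i.e. x is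
-- extremal.  So every part of D has at least two vertices except for at most
-- two singletons, and as the parts are disjoint,
--   2·|D| ≤ Σ|M| + #singletons ≤ n + 2,   hence |D| ≤ ⌊(n+2)/2⌋ = ⌈(n+1)/2⌉.
--
-- In the transitive tournament (x → y iff x < y) every convex
-- set of vertices is a module, so {0}, {1,2}, {3,4}, … (the last part
-- possibly a singleton {n-1}) are co-modules: ⌈(n+1)/2⌉ of them.

open import Defs
open import Data.Nat using (ℕ; zero; suc; _+_; _≤_; _<_; z≤n; s≤s; ⌊_/2⌋; ⌈_/2⌉; _<?_; _≤?_)
open import Data.Nat.Properties as ℕ
  using (≤-refl; ≤-trans; ≤-reflexive; +-suc; +-assoc; +-mono-≤; <-irrefl; <-asym; ≮⇒≥)
open import Data.Bool using (true; false; not)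
open import Data.Bool.Properties using (⇔→≡; not-¬; not-involutive)
open import Data.Fin using (Fin; toℕ; fromℕ<)
open import Data.Fin.Properties using (toℕ-injective; toℕ-fromℕ<; toℕ<n; fromℕ<-injective)
open import Data.Fin.Subset
open import Data.Fin.Subset.Properties
open import Data.Vec using ([]; _∷_; tabulate; here)
open import Data.Vec.Properties using ([]=⇒lookup; lookup⇒[]=; lookup∘tabulate)
open import Data.List using (List; []; _∷_; length; map)
open import Data.Nat.ListAction using (sum)
open import Data.List.Relation.Unary.All as All using (All; []; _∷_)
open import Data.List.Relation.Unary.AllPairs using (AllPairs; []; _∷_)
open import Data.Product using (Σ; _×_; _,_; proj₁; proj₂)
open import Data.Sum using (_⊎_; inj₁; inj₂)
open import Data.Empty using (⊥-elim)
open import Function.Base using (_∘_)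
open import Function.Bundles using (mk⇔)
open import Relation.Nullary using (¬_; Dec; yes; no; does)
open import Relation.Binary.Definitions using (tri<; tri≈; tri>)
open import Relation.Nullary.Decidable using (dec-true; dec-false; _×-dec_)
open import Level using (0ℓ)
open import Relation.Unary using (Pred; Decidable)
open import Relation.Binary.PropositionalEquality

half-bound : ∀ {L m} → L + L ≤ m → L ≤ ⌊ m /2⌋
half-bound {L} h = ≤-trans (≤-reflexive (ℕ.n≡⌊n+n/2⌋ L)) (ℕ.⌊n/2⌋-mono h)

⌊n/2⌋+⌊n/2⌋≤n : ∀ n → ⌊ n /2⌋ + ⌊ n /2⌋ ≤ n
⌊n/2⌋+⌊n/2⌋≤n n =
  ≤-trans (ℕ.+-monoʳ-≤ ⌊ n /2⌋ (ℕ.⌊n/2⌋≤⌈n/2⌉ n)) (≤-reflexive (ℕ.⌊n/2⌋+⌈n/2⌉≡n n))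

∁⊥≡⊤ : ∀ {n} → ∁ (⊥ {n}) ≡ ⊤
∁⊥≡⊤ {zero}  = refl
∁⊥≡⊤ {suc n} = cong (true ∷_) ∁⊥≡⊤

nontrivial : ∀ {n} {M : Subset n} {x y w} → x ∈ M → y ∈ M → x ≢ y → w ∉ M → ¬ IsTrivial M
nontrivial x∈M y∈M x≢y w∉M (inj₁ refl)               = ∉⊥ x∈M
nontrivial x∈M y∈M x≢y w∉M (inj₂ (inj₁ (z , refl))) =
  x≢y (trans (x∈⁅y⁆⇒x≡y z x∈M) (sym (x∈⁅y⁆⇒x≡y z y∈M)))
nontrivial x∈M y∈M x≢y w∉M (inj₂ (inj₂ refl))       = w∉M ∈⊤

∣p∣+∣q∣≤∣p∪q∣ : ∀ {n} (p q : Subset n) → Disjoint p q → ∣ p ∣ + ∣ q ∣ ≤ ∣ p ∪ q ∣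
∣p∣+∣q∣≤∣p∪q∣ []            []            _   = z≤n
∣p∣+∣q∣≤∣p∪q∣ (true  ∷ p) (true  ∷ q) p#q = ⊥-elim (p#q (Data.Fin.zero , here))
∣p∣+∣q∣≤∣p∪q∣ (true  ∷ p) (false ∷ q) p#q = s≤s (∣p∣+∣q∣≤∣p∪q∣ p q (drop-∷-Empty p#q))
∣p∣+∣q∣≤∣p∪q∣ (false ∷ p) (true  ∷ q) p#q rewrite +-suc ∣ p ∣ ∣ q ∣ =
  s≤s (∣p∣+∣q∣≤∣p∪q∣ p q (drop-∷-Empty p#q))
∣p∣+∣q∣≤∣p∪q∣ (false ∷ p) (false ∷ q) p#q = ∣p∣+∣q∣≤∣p∪q∣ p q (drop-∷-Empty p#q)

disjoint-⋃ : ∀ {n} (M : Subset n) (D : List (Subset n)) → All (Disjoint M) D → Disjoint M (⋃ D)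
disjoint-⋃ M []      []           (x , x∈M∩⊥) = ∉⊥ (proj₂ (x∈p∩q⁻ M ⊥ x∈M∩⊥))
disjoint-⋃ M (N ∷ D) (M#N ∷ M#D) (x , x∈M∩∪) with x∈p∩q⁻ M (N ∪ ⋃ D) x∈M∩∪
... | x∈M , x∈∪ with x∈p∪q⁻ N (⋃ D) x∈∪
...   | inj₁ x∈N = M#N (x , x∈p∩q⁺ (x∈M , x∈N))
...   | inj₂ x∈⋃ = disjoint-⋃ M D M#D (x , x∈p∩q⁺ (x∈M , x∈⋃))

totalSize : ∀ {n} → List (Subset n) → ℕ
totalSize D = sum (map ∣_∣ D)

totalSize≤n : ∀ {n} (D : List (Subset n)) → AllPairs Disjoint D → totalSize D ≤ n
totalSize≤n D D# = ≤-trans (totalSize≤∣⋃∣ D D#) (∣p∣≤n (⋃ D))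
  where
  totalSize≤∣⋃∣ : ∀ {n} (D : List (Subset n)) → AllPairs Disjoint D → totalSize D ≤ ∣ ⋃ D ∣
  totalSize≤∣⋃∣ []      []           = z≤n
  totalSize≤∣⋃∣ (M ∷ D) (M#D ∷ D#) =
    ≤-trans (ℕ.+-monoʳ-≤ ∣ M ∣ (totalSize≤∣⋃∣ D D#)) (∣p∣+∣q∣≤∣p∪q∣ M (⋃ D) (disjoint-⋃ M D M#D))

module UpperBound {n : ℕ} (T : Tournament n) where

  -- x is extremal when all arcs at x point the same way: x dominates every
  -- other vertex, or every other vertex dominates x.
  IsExtremal : Fin n → Set
  IsExtremal x = ∀ y z → y ≢ x → z ≢ x → arc T x y ≡ arc T x z

  -- No three distinct vertices are extremal: following the arcs around
  -- x, y, z would force arc T y x to equal both arc T x y and its negation.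
  no-three-extremal : ∀ {x y z} → x ≢ y → x ≢ z → y ≢ z →
                      ¬ (IsExtremal x × IsExtremal y × IsExtremal z)
  no-three-extremal {x} {y} {z} x≢y x≢z y≢z (ex , ey , ez) =
    not-¬ arc-yx≡arc-xy (tourn T x y x≢y)
    where
    open ≡-Reasoning
    arc-yx≡arc-xy : arc T y x ≡ arc T x y
    arc-yx≡arc-xy = begin
      arc T y x             ≡⟨ ey x z x≢y (≢-sym y≢z) ⟩
      arc T y z             ≡⟨ tourn T z y (≢-sym y≢z) ⟩
      not (arc T z y)       ≡⟨ cong not (ez y x y≢z x≢z) ⟩
      not (arc T z x)       ≡⟨ cong not (tourn T x z x≢z) ⟩
      not (not (arc T x z)) ≡⟨ not-involutive (arc T x z) ⟩
      arc T x z             ≡⟨ ex z y (≢-sym x≢z) (≢-sym x≢y) ⟩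
      arc T x y             ∎

  extremal-count : ∀ xs → All IsExtremal xs → AllPairs _≢_ xs → length xs ≤ 2
  extremal-count []              _                  _ = z≤n
  extremal-count (_ ∷ [])        _                  _ = s≤s z≤n
  extremal-count (_ ∷ _ ∷ [])    _                  _ = s≤s (s≤s z≤n)
  extremal-count (_ ∷ _ ∷ _ ∷ _) (ex ∷ ey ∷ ez ∷ _) ((x≢y ∷ x≢z ∷ _) ∷ (y≢z ∷ _) ∷ _) =
    ⊥-elim (no-three-extremal x≢y x≢z y≢z (ex , ey , ez))

  -- Co-modules are nonempty: ∅ is trivial, and so is its complement V.
  co-module-nonempty : ∀ M → IsCoModule T M → Nonempty M
  co-module-nonempty M co-M with nonempty? M
  ... | yes M≠∅ = M≠∅
  ... | no  M=∅ with co-M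
  ...   | inj₁ (_ , M-nontrivial)  = ⊥-elim (M-nontrivial (inj₁ (Empty-unique M=∅)))
  ...   | inj₂ (_ , ∁M-nontrivial) =
    ⊥-elim (∁M-nontrivial (inj₂ (inj₂ (trans (cong ∁ (Empty-unique M=∅)) ∁⊥≡⊤))))

  -- A singleton {x} is a co-module only if V ∖ {x} is a module, i.e. only if
  -- x is extremal.
  singleton-co-module⇒extremal : ∀ x → IsCoModule T ⁅ x ⁆ → IsExtremal x
  singleton-co-module⇒extremal x (inj₁ (_ , ⁅x⁆-nontrivial)) = ⊥-elim (⁅x⁆-nontrivial (inj₂ (inj₁ (x , refl))))
  singleton-co-module⇒extremal x (inj₂ (∁⁅x⁆-module , _)) y z y≢x z≢x =
    ⇔→≡ (mk⇔ (proj₁ same-side) (proj₂ same-side))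
    where
    ∈∁⁅x⁆ : ∀ {u} → u ≢ x → u ∈ ∁ ⁅ x ⁆
    ∈∁⁅x⁆ u≢x = x∉p⇒x∈∁p (x≢y⇒x∉⁅y⁆ u≢x)
    same-side : (arc T x y ≡ true → arc T x z ≡ true) × (arc T x z ≡ true → arc T x y ≡ true)
    same-side = ∁⁅x⁆-module y z x (∈∁⁅x⁆ y≢x) (∈∁⁅x⁆ z≢x) (x∈p⇒x∉∁p (x∈⁅x⁆ x))

  co-module-shape : ∀ M → IsCoModule T M →
                    (Σ (Fin n) λ x → M ≡ ⁅ x ⁆ × IsExtremal x) ⊎ (2 ≤ ∣ M ∣)
  co-module-shape M co-M with co-module-nonempty M co-M
  ... | x , x∈M with ⁅ x ⁆ ⊂? M
  ...   | yes ⁅x⁆⊂M = inj₂ (subst (_< ∣ M ∣) (∣⁅x⁆∣≡1 x) (p⊂q⇒∣p∣<∣q∣ ⁅x⁆⊂M))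
  ...   | no  ⁅x⁆⊄M = inj₁ (x , M≡⁅x⁆ , singleton-co-module⇒extremal x (subst (IsCoModule T) M≡⁅x⁆ co-M))
    where
    ⁅x⁆⊆M : ⁅ x ⁆ ⊆ M
    ⁅x⁆⊆M y∈⁅x⁆ = subst (_∈ M) (sym (x∈⁅y⁆⇒x≡y x y∈⁅x⁆)) x∈M
    M⊆⁅x⁆ : M ⊆ ⁅ x ⁆
    M⊆⁅x⁆ {y} y∈M with y ∈? ⁅ x ⁆
    ... | yes y∈⁅x⁆ = y∈⁅x⁆
    ... | no  y∉⁅x⁆ = ⊥-elim (⁅x⁆⊄M (⁅x⁆⊆M , y , y∈M , y∉⁅x⁆))
    M≡⁅x⁆ : M ≡ ⁅ x ⁆
    M≡⁅x⁆ = ⊆-antisym M⊆⁅x⁆ ⁅x⁆⊆M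

  -- The double-counting invariant for a family D of co-modules: the
  -- singletons of D are recorded as a list of distinct extremal vertices
  -- of ⋃ D, and each member of D contributes at least 2 to the total size,
  -- counting each recorded singleton once more.
  record SingletonWitnesses (D : List (Subset n)) : Set where
    field
      vertices     : List (Fin n)
      extremal     : All IsExtremal vertices
      distinct     : AllPairs _≢_ vertices
      covered      : All (_∈ ⋃ D) vertices
      double-count : length D + length D ≤ totalSize D + length vertices

  add-large : ∀ {M D} → 2 ≤ ∣ M ∣ → SingletonWitnesses D → SingletonWitnesses (M ∷ D)
  add-large {M} {D} 2≤∣M∣ w = record
    { vertices = vertices ; extremal = extremal ; distinct = distinct
    ; covered = All.map (q⊆p∪q M (⋃ D)) covered
    ; double-count = begin
        suc L + suc L                           ≡⟨ cong suc (+-suc L L) ⟩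
        2 + (L + L)                             ≤⟨ +-mono-≤ 2≤∣M∣ double-count ⟩
        ∣ M ∣ + (totalSize D + length vertices) ≡⟨ +-assoc ∣ M ∣ (totalSize D) (length vertices) ⟨
        ∣ M ∣ + totalSize D + length vertices   ∎ }
    where
    open SingletonWitnesses w
    open ℕ.≤-Reasoning
    L : ℕ
    L = length D

  add-singleton : ∀ {x D} → IsExtremal x → Disjoint ⁅ x ⁆ (⋃ D) →
                  SingletonWitnesses D → SingletonWitnesses (⁅ x ⁆ ∷ D)
  add-singleton {x} {D} ex x#D w = record
    { vertices = x ∷ vertices ; extremal = ex ∷ extremal
    ; distinct = All.map x≢ covered ∷ distinct
    ; covered = p⊆p∪q (⋃ D) (x∈⁅x⁆ x) ∷ All.map (q⊆p∪q ⁅ x ⁆ (⋃ D)) covered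
    ; double-count = begin
        suc L + suc L                                   ≡⟨ cong suc (+-suc L L) ⟩
        2 + (L + L)                                     ≤⟨ s≤s (s≤s double-count) ⟩
        2 + (totalSize D + length vertices)             ≡⟨ cong suc (+-suc (totalSize D) (length vertices)) ⟨
        suc (totalSize D + suc (length vertices))       ≡⟨ cong (λ k → k + totalSize D + suc (length vertices)) (∣⁅x⁆∣≡1 x) ⟨
        ∣ ⁅ x ⁆ ∣ + totalSize D + suc (length vertices) ∎ }
    where
    open SingletonWitnesses w
    open ℕ.≤-Reasoning
    L : ℕ
    L = length D
    x≢ : ∀ {y} → y ∈ ⋃ D → x ≢ y
    x≢ y∈⋃D refl = x#D (x , x∈p∩q⁺ (x∈⁅x⁆ x , y∈⋃D))

  witnesses : ∀ D → IsCoModularDecomposition T D → SingletonWitnesses D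
  witnesses [] _ = record
    { vertices = [] ; extremal = [] ; distinct = [] ; covered = [] ; double-count = z≤n }
  witnesses (M ∷ D) (co-M ∷ co-D , M#D ∷ D#) with co-module-shape M co-M
  ... | inj₂ 2≤∣M∣           = add-large 2≤∣M∣ (witnesses D (co-D , D#))
  ... | inj₁ (x , refl , ex) = add-singleton ex (disjoint-⋃ ⁅ x ⁆ D M#D) (witnesses D (co-D , D#))

  decomposition-bound : ∀ D → IsCoModularDecomposition T D → length D ≤ ⌈ suc n /2⌉
  decomposition-bound D D-dec@(_ , D#) = half-bound (begin
    length D + length D            ≤⟨ double-count ⟩
    totalSize D + length vertices  ≤⟨ +-mono-≤ (totalSize≤n D D#) (extremal-count vertices extremal distinct) ⟩
    n + 2                          ≡⟨ ℕ.+-comm n 2 ⟩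
    suc (suc n)                    ∎)
    where
    open SingletonWitnesses (witnesses D D-dec)
    open ℕ.≤-Reasoning

does⇒witness : ∀ {A : Set} (a? : Dec A) → does a? ≡ true → A
does⇒witness (yes a) _ = a

selection : ∀ {n} {P : Pred (Fin n) 0ℓ} → Decidable P → Subset n
selection P? = tabulate (λ x → does (P? x))

∈-selection⁺ : ∀ {n} {P : Pred (Fin n) 0ℓ} (P? : Decidable P) {x} → P x → x ∈ selection P?
∈-selection⁺ P? {x} Px = lookup⇒[]= x _ (trans (lookup∘tabulate _ x) (dec-true (P? x) Px))

∈-selection⁻ : ∀ {n} {P : Pred (Fin n) 0ℓ} (P? : Decidable P) {x} → x ∈ selection P? → P x
∈-selection⁻ P? {x} x∈ =
  does⇒witness (P? x) (trans (sym (lookup∘tabulate _ x)) ([]=⇒lookup x∈))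

module LowerBound (n : ℕ) where

  transitive : Tournament n
  transitive = record { arc = λ x y → does (toℕ x <? toℕ y) ; irrefl = irrefl′ ; tourn = tourn′ }
    where
    irrefl′ : ∀ x → does (toℕ x <? toℕ x) ≡ false
    irrefl′ x = dec-false (toℕ x <? toℕ x) (<-irrefl refl)
    tourn′ : ∀ x y → x ≢ y → does (toℕ y <? toℕ x) ≡ not (does (toℕ x <? toℕ y))
    tourn′ x y x≢y with ℕ.<-cmp (toℕ x) (toℕ y)
    ... | tri< x<y _ _ = trans (dec-false (toℕ y <? toℕ x) (<-asym x<y))
                               (cong not (sym (dec-true (toℕ x <? toℕ y) x<y)))
    ... | tri≈ _ x≡y _ = ⊥-elim (x≢y (toℕ-injective x≡y))
    ... | tri> _ _ y<x = trans (dec-true (toℕ y <? toℕ x) y<x)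
                               (cong not (sym (dec-false (toℕ x <? toℕ y) (<-asym y<x))))

  arc⇒< : ∀ {x y} → arc transitive x y ≡ true → toℕ x < toℕ y
  arc⇒< {x} {y} h = does⇒witness (toℕ x <? toℕ y) h

  <⇒arc : ∀ {x y} → toℕ x < toℕ y → arc transitive x y ≡ true
  <⇒arc {x} {y} x<y = dec-true (toℕ x <? toℕ y) x<y

  Convex : Subset n → Set
  Convex M = ∀ {x y z} → x ∈ M → z ∈ M → toℕ x ≤ toℕ y → toℕ y ≤ toℕ z → y ∈ M

  -- A vertex outside a convex set that lies below one of its members lies
  -- below all of them; so convex sets are modules of the transitive tournament.
  convex⇒module : ∀ {M} → Convex M → IsModule transitive M
  convex⇒module {M} convex x y v x∈M y∈M v∉M =
    (λ v→x → <⇒arc (below-all x∈M y∈M (arc⇒< v→x))) , (λ v→y → <⇒arc (below-all y∈M x∈M (arc⇒< v→y)))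
    where
    below-all : ∀ {x y} → x ∈ M → y ∈ M → toℕ v < toℕ x → toℕ v < toℕ y
    below-all {x} {y} x∈M y∈M v<x with toℕ v <? toℕ y
    ... | yes v<y = v<y
    ... | no  v≮y = ⊥-elim (v∉M (convex y∈M x∈M (≮⇒≥ v≮y) (ℕ.<⇒≤ v<x)))

  interval : ℕ → ℕ → Subset n
  interval a b = selection (λ x → (a ≤? toℕ x) ×-dec (toℕ x ≤? b))

  ∈-interval⁺ : ∀ a b {x} → a ≤ toℕ x → toℕ x ≤ b → x ∈ interval a b
  ∈-interval⁺ a b a≤x x≤b = ∈-selection⁺ (λ x → (a ≤? toℕ x) ×-dec (toℕ x ≤? b)) (a≤x , x≤b)

  ∈-interval⁻ : ∀ a b {x} → x ∈ interval a b → a ≤ toℕ x × toℕ x ≤ b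
  ∈-interval⁻ a b = ∈-selection⁻ (λ x → (a ≤? toℕ x) ×-dec (toℕ x ≤? b))

  interval-convex : ∀ a b → Convex (interval a b)
  interval-convex a b x∈I z∈I x≤y y≤z =
    ∈-interval⁺ a b (≤-trans (proj₁ (∈-interval⁻ a b x∈I)) x≤y) (≤-trans y≤z (proj₂ (∈-interval⁻ a b z∈I)))

  ∁-initial-convex : ∀ b → Convex (∁ (interval 0 b))
  ∁-initial-convex b x∈∁I z∈∁I x≤y y≤z = x∉p⇒x∈∁p λ y∈I →
    x∈∁p⇒x∉p x∈∁I (∈-interval⁺ 0 b z≤n (≤-trans x≤y (proj₂ (∈-interval⁻ 0 b y∈I))))

  ∁-final-convex : ∀ a b → n ≤ suc b → Convex (∁ (interval a b))
  ∁-final-convex a b n≤1+b x∈∁I z∈∁I x≤y y≤z = x∉p⇒x∈∁p λ y∈I →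
    x∈∁p⇒x∉p z∈∁I (∈-interval⁺ a b (≤-trans (proj₁ (∈-interval⁻ a b y∈I)) y≤z)
                                    (ℕ.≤-pred (≤-trans (toℕ<n _) n≤1+b)))

  index-∈ : ∀ a b {k} (k<n : k < n) → a ≤ k → k ≤ b → fromℕ< k<n ∈ interval a b
  index-∈ a b k<n a≤k k≤b = ∈-interval⁺ a b (subst (a ≤_) (sym (toℕ-fromℕ< k<n)) a≤k)
                                            (subst (_≤ b) (sym (toℕ-fromℕ< k<n)) k≤b)

  index-∉ : ∀ a b {k} (k<n : k < n) → ¬ (a ≤ k × k ≤ b) → fromℕ< k<n ∉ interval a b
  index-∉ a b k<n k∉[a,b] x∈I =
    k∉[a,b] (subst (λ i → a ≤ i × i ≤ b) (toℕ-fromℕ< k<n) (∈-interval⁻ a b x∈I))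

  index-injective : ∀ {j k} (j<n : j < n) (k<n : k < n) → j ≢ k → fromℕ< j<n ≢ fromℕ< k<n
  index-injective {j} {k} j<n k<n j≢k eq = j≢k (fromℕ<-injective j k j<n k<n eq)

  -- k two-element intervals [a, a+1], [a+2, a+3], … (the last one may be
  -- cut off at n-1).
  pairs : ℕ → ℕ → List (Subset n)
  pairs zero    a = []
  pairs (suc k) a = interval a (suc a) ∷ pairs k (suc (suc a))

  length-pairs : ∀ k a → length (pairs k a) ≡ k
  length-pairs zero    a = refl
  length-pairs (suc k) a = cong suc (length-pairs k (suc (suc a)))

  AtLeast : ℕ → Subset n → Set
  AtLeast a M = ∀ {x} → x ∈ M → a ≤ toℕ x

  pairs-at-least : ∀ k a → All (AtLeast a) (pairs k a)
  pairs-at-least zero    a = []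
  pairs-at-least (suc k) a =
    (λ x∈I → proj₁ (∈-interval⁻ a (suc a) x∈I)) ∷
    All.map (λ above {x} x∈M → ≤-trans (ℕ.m≤n+m a 2) (above x∈M)) (pairs-at-least k (suc (suc a)))

  interval-disjoint : ∀ a b {M} → AtLeast (suc b) M → Disjoint (interval a b) M
  interval-disjoint a b {M} above (x , x∈I∩M) =
    ℕ.<⇒≱ (above (proj₂ both)) (proj₂ (∈-interval⁻ a b (proj₁ both)))
    where
    both : x ∈ interval a b × x ∈ M
    both = x∈p∩q⁻ (interval a b) M x∈I∩M

  pairs-disjoint : ∀ k a → AllPairs Disjoint (pairs k a)
  pairs-disjoint zero    a = []
  pairs-disjoint (suc k) a =
    All.map (interval-disjoint a (suc a)) (pairs-at-least k (suc (suc a))) ∷ pairs-disjoint k (suc (suc a))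

  module _ (n≥3 : 3 ≤ n) where

    0<n : 0 < n
    0<n = ≤-trans (s≤s z≤n) n≥3
    1<n : 1 < n
    1<n = ≤-trans (s≤s (s≤s z≤n)) n≥3

    -- The complement of {0} is a final segment containing 1 and 2.
    first-part : IsCoModule transitive (interval 0 0)
    first-part = inj₂ (convex⇒module (∁-initial-convex 0) ,
      nontrivial (x∉p⇒x∈∁p (index-∉ 0 0 1<n λ { (_ , ()) })) (x∉p⇒x∈∁p (index-∉ 0 0 n≥3 λ { (_ , ()) }))
                 (index-injective 1<n n≥3 λ ()) (x∈p⇒x∉∁p (index-∈ 0 0 0<n z≤n z≤n)))

    -- If a+1 < n the interval is a two-element module missing 0; otherwise it
    -- is {n-1}, whose complement is an initial segment containing 0 and 1.
    pair-part : ∀ a → 1 ≤ a → a < n → IsCoModule transitive (interval a (suc a))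
    pair-part a 1≤a a<n with suc a <? n
    ... | yes 1+a<n = inj₁ (convex⇒module (interval-convex a (suc a)) ,
      nontrivial (index-∈ a (suc a) a<n ≤-refl (ℕ.n≤1+n a)) (index-∈ a (suc a) 1+a<n (ℕ.n≤1+n a) ≤-refl)
                 (index-injective a<n 1+a<n (ℕ.<⇒≢ ≤-refl))
                 (index-∉ a (suc a) 0<n λ (a≤0 , _) → ℕ.<⇒≱ 1≤a a≤0))
    ... | no  1+a≮n = inj₂ (convex⇒module (∁-final-convex a (suc a) (≤-trans n≤1+a (ℕ.n≤1+n _))) ,
      nontrivial (x∉p⇒x∈∁p (index-∉ a (suc a) 0<n λ (a≤0 , _) → ℕ.<⇒≱ 1≤a a≤0))
                 (x∉p⇒x∈∁p (index-∉ a (suc a) 1<n λ (a≤1 , _) → ℕ.<⇒≱ 2≤a a≤1))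
                 (index-injective 0<n 1<n λ ())
                 (x∈p⇒x∉∁p (index-∈ a (suc a) a<n ≤-refl (ℕ.n≤1+n a))))
      where
      n≤1+a : n ≤ suc a
      n≤1+a = ≮⇒≥ 1+a≮n
      2≤a : 2 ≤ a
      2≤a = ℕ.≤-pred (≤-trans n≥3 n≤1+a)

    pairs-co-modules : ∀ k a → 1 ≤ a → a + k + k ≤ suc n → All (IsCoModule transitive) (pairs k a)
    pairs-co-modules zero    a _   _    = []
    pairs-co-modules (suc k) a 1≤a fits =
      pair-part a 1≤a a<n ∷ pairs-co-modules k (suc (suc a)) (≤-trans 1≤a (ℕ.m≤n+m a 2)) fits′
      where
      fits′ : suc (suc a) + k + k ≤ suc n
      fits′ = subst (_≤ suc n) (trans (+-suc (a + suc k) k) (cong (suc ∘ (_+ k)) (+-suc a k))) fits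
      a<n : a < n
      a<n = ≤-trans (s≤s (≤-trans (ℕ.m≤m+n a k) (ℕ.m≤m+n (a + k) k))) (ℕ.≤-pred fits′)

  staircase : List (Subset n)
  staircase = interval 0 0 ∷ pairs ⌊ n /2⌋ 1

  length-staircase : length staircase ≡ ⌈ suc n /2⌉
  length-staircase = cong suc (length-pairs ⌊ n /2⌋ 1)

  staircase-decomposition : 3 ≤ n → IsCoModularDecomposition transitive staircase
  staircase-decomposition n≥3 =
    first-part n≥3 ∷ pairs-co-modules n≥3 ⌊ n /2⌋ 1 ≤-refl (s≤s (⌊n/2⌋+⌊n/2⌋≤n n)) ,
    All.map (interval-disjoint 0 0) (pairs-at-least ⌊ n /2⌋ 1) ∷ pairs-disjoint ⌊ n /2⌋ 1

theorem3 : (n : ℕ) → 3 ≤ n → IsMaxCoModularIndex n ⌈ suc n /2⌉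
theorem3 n n≥3 =
  (transitive , (staircase , staircase-decomposition n≥3 , length-staircase) , decomposition-bound transitive) ,
  λ { T _ ((D , D-dec , refl) , _) → decomposition-bound T D D-dec }
  where
  open LowerBound n
  open UpperBound using (decomposition-bound)
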